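{- Let $G$ be a unicyclic graph and let $\mathcal{C}$ be its unique cycle. (a) If $v$ is an appropriate vertex of $G$ with $v \notin V(\mathcal{C})$, then $sdim(G-v)-1 \le sdim(G)$. (b) If $P$ is an isolated path in $G$ (a connected component of $G$ that is a path with at least two vertices), then $sdim(G-V(P))+1 = sdim(G)$. (c) If $\ell$ is a peripheral leaf of $G$, then $sdim(G-\ell)=sdim(G)$.
   Context: A graph is unicyclic if it contains exactly one cycle (it need not be connected). A vertex $x$ strongly resolves a pair $u,v$ of vertices in a connected graph if $u$ lies on some shortest $x$–$v$ path or $v$ lies on some shortest $x$–$u$ path; $W$ is a strong resolving set of a connected graph if every pair of distinct vertices is strongly resolved by some vertex of $W$, and $sdim$ of a connected graph is the minimum size of a strong resolving set. For a disconnected graph, $sdim$ is defined additively: $sdim(G_1 \cup G_2)=sdim(G_1)+sdim(G_2)$ for a disjoint union, i.e., $sdim$ is the sum of $sdim$ over connected components. A vertex $v$ of $G$ is appropriate if at least two connected components of $G-v$ are paths. A vertex $\ell$ is a peripheral leaf if $\deg(\ell)=1$ and its unique neighbor $u$ has $\deg(u)=2$. -}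

module Defs where

open import Level using (0ℓ)
open import Data.Bool using (Bool; true; false)
open import Data.Nat using (ℕ; zero; suc; _+_; _≤_)
open import Data.Fin using (Fin; zero; suc; toℕ; inject₁; fromℕ)
open import Data.Fin.Subset using (Subset; _∈_; ∣_∣)
open import Data.Vec using (tabulate)
open import Data.Product using (Σ; ∃; ∃-syntax; _×_; _,_)
open import Data.Sum using (_⊎_)
open import Relation.Nullary using (¬_)
open import Relation.Unary using (Pred; _∖_)
open import Relation.Binary.PropositionalEquality using (_≡_; _≢_)
open import Function.Definitions using (Injective)

record Graph (n : ℕ) : Set where
  field
    adj    : Fin n → Fin n → Bool
    sym    : ∀ u v → adj u v ≡ adj v u
    irrefl : ∀ v → adj v v ≡ false
open Graph public

module _ {n : ℕ} (G : Graph n) where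

  Edge : Fin n → Fin n → Set
  Edge u v = adj G u v ≡ true

  deg : Fin n → ℕ
  deg v = ∣ tabulate (adj G v) ∣

  -- Vertex sets are predicates; a vertex set S stands for the induced subgraph G[S].
  VSet : Set₁
  VSet = Pred (Fin n) 0ℓ

  data Walk (S : VSet) : Fin n → Fin n → ℕ → Set where
    stop : ∀ {u} → S u → Walk S u u 0
    step : ∀ {u w v k} → S u → Edge u w → Walk S w v k → Walk S u v (suc k)

  Dist : VSet → Fin n → Fin n → ℕ → Set
  Dist S u v d = Walk S u v d × (∀ k → Walk S u v k → d ≤ k)

  OnGeodesic : VSet → Fin n → Fin n → Fin n → Set
  OnGeodesic S x u v =
    ∃[ a ] ∃[ b ] ∃[ d ] (Walk S x u a × Walk S u v b × Dist S x v d × a + b ≡ d)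

  StronglyResolves : VSet → Fin n → Fin n → Fin n → Set
  StronglyResolves S x u v = OnGeodesic S x u v ⊎ OnGeodesic S x v u

  StrongResolvingSet : VSet → Subset n → Set
  StrongResolvingSet S W =
    (∀ x → x ∈ W → S x) ×
    (∀ u v → S u → S v → u ≢ v → ∃[ x ] (x ∈ W × StronglyResolves S x u v))

  Connected : VSet → Set
  Connected S = ∀ u v → S u → S v → ∃[ k ] Walk S u v k

  SdimConn : VSet → ℕ → Set
  SdimConn S k =
    Connected S ×
    (∃[ W ] (StrongResolvingSet S W × ∣ W ∣ ≡ k)) ×
    (∀ W → StrongResolvingSet S W → k ≤ ∣ W ∣)

  Component : VSet → VSet → Set
  Component S C =
    (∀ x → C x → S x) × (∃[ x ] C x) × Connected C ×
    (∀ x y → C x → S y → Edge x y → C y)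

  -- sdim of a possibly disconnected graph: sum of sdim over the components
  data Sdim : VSet → ℕ → Set₁ where
    none : ∀ {S} → (∀ x → ¬ S x) → Sdim S 0
    comp : ∀ {S C a b} → Component S C → SdimConn C a → Sdim (S ∖ C) b →
           Sdim S (a + b)

  IsPath : VSet → Set
  IsPath P =
    ∃[ k ] Σ (Fin (suc k) → Fin n) λ p →
      Injective _≡_ _≡_ p ×
      (∀ i → P (p i)) × (∀ x → P x → ∃[ i ] p i ≡ x) ×
      (∀ i j → (Edge (p i) (p j) → (toℕ j ≡ suc (toℕ i) ⊎ toℕ i ≡ suc (toℕ j))) ×
               ((toℕ j ≡ suc (toℕ i) ⊎ toℕ i ≡ suc (toℕ j)) → Edge (p i) (p j)))

  All : VSet
  All = Relation.Unary.U

  minus : Fin n → VSet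
  minus v x = x ≢ v

  Appropriate : Fin n → Set₁
  Appropriate v =
    ∃[ C₁ ] ∃[ C₂ ] (Component (minus v) C₁ × Component (minus v) C₂ ×
                     IsPath C₁ × IsPath C₂ × ∃[ x ] (C₁ x × ¬ C₂ x))

  IsolatedPath : VSet → Set
  IsolatedPath P =
    Component All P × IsPath P × ∃[ x ] ∃[ y ] (P x × P y × x ≢ y)

  PeripheralLeaf : Fin n → Set
  PeripheralLeaf ℓ = deg ℓ ≡ 1 × ∃[ u ] (Edge ℓ u × deg u ≡ 2)

  -- a cycle of length m+3: injective cyclic sequence of pairwise adjacent vertices
  record Cycle : Set where
    field
      m       : ℕ
      vert    : Fin (suc (suc (suc m))) → Fin n
      inj     : Injective _≡_ _≡_ vert
      consec  : ∀ (i : Fin (suc (suc m))) → Edge (vert (inject₁ i)) (vert (suc i))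
      closing : Edge (vert (fromℕ (suc (suc m)))) (vert zero)

  CycArc : Cycle → Fin n → Fin n → Set
  CycArc c a b =
    (∃[ i ] (a ≡ Cycle.vert c (inject₁ i) × b ≡ Cycle.vert c (suc i))) ⊎
    (a ≡ Cycle.vert c (fromℕ (suc (suc (Cycle.m c)))) × b ≡ Cycle.vert c zero)

  CycEdge : Cycle → Fin n → Fin n → Set
  CycEdge c a b = CycArc c a b ⊎ CycArc c b a

  OnCycle : Cycle → Fin n → Set
  OnCycle c v = ∃[ i ] Cycle.vert c i ≡ v

  -- G contains exactly one cycle (cycles identified with their edge sets)
  Unicyclic : Set
  Unicyclic =
    Cycle × (∀ c c' a b → CycEdge c a b → CycEdge c' a b)

module Submission where

-- Since sdim is additive over components, sdim G[S] is the least size of a vertex set that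
-- strongly resolves every pair of vertices lying in a common component of G[S].
--
-- (b) An endpoint of a path strongly resolves all pairs of the path, and any resolving set
-- of G meets the isolated path P, so resolving sets of G - V(P) and G differ by one vertex.
--
-- (c) Every geodesic of G leaving ℓ passes through u, and since u has a single neighbour in
-- G - ℓ it is interior to no geodesic of G - ℓ. Hence exchanging ℓ and u turns a resolving
-- set of either graph into one of the other.
--
-- (a) If v lies on no cycle, its neighbours a lie in distinct components (branches) of G - v.
-- Let W resolve G. A pair in the branch of a that is resolved from outside the branch is
-- resolved by a, and then also by a peak (a local maximum of the distance from a) further
-- along the geodesic. Peaks in distinct branches can only be resolved by themselves, so all
-- peaks outside one branch lie in W, and (W - v) plus the root of that branch resolves G - v.
--
-- Vertex sets are arbitrary predicates and distances are minima, so the argument runs in the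
-- double-negation monad; the conclusions are decidable and are recovered by stability.

open import Defs hiding (sym)
open import Level using (0ℓ)
open import Data.Bool using (Bool; true)
open import Data.Bool.Properties using (not-¬)
open import Data.Nat using (ℕ; zero; suc; _+_; _∸_; _≤_; _<_; z≤n; s≤s; _≤?_) renaming (_≟_ to _≟ℕ_)
open import Data.Nat.Properties hiding (_≟_)
open import Data.Nat.Induction using (<-wellFounded)
open import Data.Nat.Tactic.RingSolver using (solve-∀)
open import Data.Fin using (Fin; zero; suc; toℕ; fromℕ; fromℕ<; inject₁; _≟_)
open import Data.Fin.Properties using (any?; toℕ-injective; toℕ-fromℕ<; toℕ<n)
open import Data.Fin.Subset using (Subset; _∈_; _∉_; ∣_∣; ⁅_⁆; _∪_; _∩_; _─_; _-_; inside; outside) renaming (⊥ to ∅)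
open import Data.Fin.Subset.Properties
  using (_∈?_; ∣p─q∣≤∣p∣; x∈p∩q⁺; x∈p∩q⁻; x∈p∪q⁺; x∈p∪q⁻; x∈p∧x∉q⇒x∈p─q; ∉⊥; ∣⊥∣≡0; x∈⁅x⁆; x∈⁅y⁆⇒x≡y; ∣⁅x⁆∣≡1; p⊆q⇒∣p∣≤∣q∣; x∈p⇒∣p-x∣<∣p∣; x∈p∧x≢y⇒x∈p-y; drop-there)
open import Data.Vec using (_∷_; []; tabulate; here; there)
open import Data.Vec.Properties using (lookup∘tabulate; lookup⇒[]=; []=⇒lookup)
open import Data.Product using (∃; ∃-syntax; _×_; _,_; _,′_; proj₁; proj₂)
open import Data.Sum using (_⊎_; inj₁; inj₂)
open import Data.Empty using (⊥; ⊥-elim)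
open import Data.Unit using (tt)
open import Effect.Monad using (RawMonad)
open import Function using (case_of_)
open import Induction.WellFounded using (Acc; acc)
open import Relation.Nullary using (¬_; Dec; yes; no; does; contradiction)
open import Relation.Nullary.Decidable using (¬?; _×-dec_; dec-true; decidable-stable; ¬¬-excluded-middle)
open import Relation.Nullary.Negation using (¬¬-Monad)
open import Relation.Unary using (Pred; Decidable; _⊆_; _∖_; ∁)
open import Relation.Binary.PropositionalEquality
open import Function.Definitions using (Injective)
open import Relation.Binary.Definitions using (tri<; tri≈; tri>)

open RawMonad (¬¬-Monad {0ℓ}) using (_>>=_; pure)

private
  variable
    m k : ℕ
    x y z : Fin m
    p q : Subset m

-- Finite subsets

x∈p─q⁻ : ∀ (p q : Subset m) → x ∈ p ─ q → x ∈ p × x ∉ q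
x∈p─q⁻ (_ ∷ p) (inside ∷ q) (there x∈) with x∈p─q⁻ p q x∈
... | x∈p , x∉q = there x∈p , λ x∈q → x∉q (drop-there x∈q)
x∈p─q⁻ (_ ∷ p) (outside ∷ q) here = here , λ ()
x∈p─q⁻ (_ ∷ p) (outside ∷ q) (there x∈) with x∈p─q⁻ p q x∈
... | x∈p , x∉q = there x∈p , λ x∈q → x∉q (drop-there x∈q)

∣p∪q∣≤∣p∣+∣q∣ : ∀ (p q : Subset m) → ∣ p ∪ q ∣ ≤ ∣ p ∣ + ∣ q ∣
∣p∪q∣≤∣p∣+∣q∣ []            []            = z≤n
∣p∪q∣≤∣p∣+∣q∣ (inside  ∷ p) (inside  ∷ q) = s≤s (≤-trans (∣p∪q∣≤∣p∣+∣q∣ p q) (+-monoʳ-≤ ∣ p ∣ (n≤1+n ∣ q ∣)))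
∣p∪q∣≤∣p∣+∣q∣ (inside  ∷ p) (outside ∷ q) = s≤s (∣p∪q∣≤∣p∣+∣q∣ p q)
∣p∪q∣≤∣p∣+∣q∣ (outside ∷ p) (inside  ∷ q) = subst (suc ∣ p ∪ q ∣ ≤_) (sym (+-suc ∣ p ∣ ∣ q ∣)) (s≤s (∣p∪q∣≤∣p∣+∣q∣ p q))
∣p∪q∣≤∣p∣+∣q∣ (outside ∷ p) (outside ∷ q) = ∣p∪q∣≤∣p∣+∣q∣ p q

∣p∣≡∣p∩q∣+∣p─q∣ : ∀ (p q : Subset m) → ∣ p ∣ ≡ ∣ p ∩ q ∣ + ∣ p ─ q ∣
∣p∣≡∣p∩q∣+∣p─q∣ []            []            = refl
∣p∣≡∣p∩q∣+∣p─q∣ (inside  ∷ p) (inside  ∷ q) = cong suc (∣p∣≡∣p∩q∣+∣p─q∣ p q)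
∣p∣≡∣p∩q∣+∣p─q∣ (inside  ∷ p) (outside ∷ q) = trans (cong suc (∣p∣≡∣p∩q∣+∣p─q∣ p q)) (sym (+-suc ∣ p ∩ q ∣ ∣ p ─ q ∣))
∣p∣≡∣p∩q∣+∣p─q∣ (outside ∷ p) (inside  ∷ q) = ∣p∣≡∣p∩q∣+∣p─q∣ p q
∣p∣≡∣p∩q∣+∣p─q∣ (outside ∷ p) (outside ∷ q) = ∣p∣≡∣p∩q∣+∣p─q∣ p q

p⊆⁅x⁆⇒∣p∣≤1 : (∀ {y} → y ∈ p → y ∈ ⁅ x ⁆) → ∣ p ∣ ≤ 1
p⊆⁅x⁆⇒∣p∣≤1 {x = x} p⊆ = ≤-trans (p⊆q⇒∣p∣≤∣q∣ p⊆) (≤-reflexive (∣⁅x⁆∣≡1 x))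

x∈p⇒0<∣p∣ : x ∈ p → 0 < ∣ p ∣
x∈p⇒0<∣p∣ {x = x} x∈p =
  ≤-trans (≤-reflexive (sym (∣⁅x⁆∣≡1 x))) (p⊆q⇒∣p∣≤∣q∣ λ y∈⁅x⁆ → subst (_∈ _) (sym (x∈⁅y⁆⇒x≡y x y∈⁅x⁆)) x∈p)

x,y∈p⇒1<∣p∣ : x ∈ p → y ∈ p → x ≢ y → 1 < ∣ p ∣
x,y∈p⇒1<∣p∣ x∈p y∈p x≢y = ≤-trans (s≤s (x∈p⇒0<∣p∣ (x∈p∧x≢y⇒x∈p-y y∈p (≢-sym x≢y)))) (x∈p⇒∣p-x∣<∣p∣ x∈p)

∣p∣≤1⇒x≡y : ∣ p ∣ ≤ 1 → x ∈ p → y ∈ p → x ≡ y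
∣p∣≤1⇒x≡y {x = x} {y = y} ∣p∣≤1 x∈p y∈p =
  decidable-stable (x ≟ y) λ x≢y → <⇒≱ (x,y∈p⇒1<∣p∣ x∈p y∈p x≢y) ∣p∣≤1

∣p∣≤2⇒y≡z : ∣ p ∣ ≤ 2 → x ∈ p → y ∈ p → z ∈ p → x ≢ y → x ≢ z → y ≡ z
∣p∣≤2⇒y≡z {p = p} {x = x} ∣p∣≤2 x∈p y∈p z∈p x≢y x≢z =
  ∣p∣≤1⇒x≡y (≤-pred (≤-trans (x∈p⇒∣p-x∣<∣p∣ x∈p) ∣p∣≤2))
            (x∈p∧x≢y⇒x∈p-y y∈p (≢-sym x≢y)) (x∈p∧x≢y⇒x∈p-y z∈p (≢-sym x≢z))

1<∣p∣⇒∃≢ : 1 < ∣ p ∣ → ∀ x → ∃[ y ] (y ∈ p × y ≢ x)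
1<∣p∣⇒∃≢ {p = p} 1<∣p∣ x with any? (λ y → y ∈? p ×-dec ¬? (y ≟ x))
... | yes other = other
... | no ¬other = contradiction (p⊆⁅x⁆⇒∣p∣≤1 p⊆⁅x⁆) (<⇒≱ 1<∣p∣)
  where
  p⊆⁅x⁆ : ∀ {y} → y ∈ p → y ∈ ⁅ x ⁆
  p⊆⁅x⁆ {y} y∈p = subst (_∈ ⁅ x ⁆) (sym (decidable-stable (y ≟ x) λ y≢x → ¬other (y , y∈p , y≢x))) (x∈⁅x⁆ x)

exchange : (W : Subset m) (s t : Fin m) → Dec (s ∈ W) → Subset m
exchange W s t (yes _) = (W - s) ∪ ⁅ t ⁆
exchange W s t (no _)  = W

module _ {W : Subset m} {s t : Fin m} where

  ∣exchange∣≤∣W∣ : (s? : Dec (s ∈ W)) → ∣ exchange W s t s? ∣ ≤ ∣ W ∣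
  ∣exchange∣≤∣W∣ (yes s∈W) =
    ≤-trans (∣p∪q∣≤∣p∣+∣q∣ (W - s) ⁅ t ⁆)
            (subst (_≤ ∣ W ∣) (sym (trans (cong (∣ W - s ∣ +_) (∣⁅x⁆∣≡1 t)) (+-comm ∣ W - s ∣ 1)))
                   (x∈p⇒∣p-x∣<∣p∣ s∈W))
  ∣exchange∣≤∣W∣ (no _) = ≤-refl

  ∈exchange⁺ : (s? : Dec (s ∈ W)) → x ∈ W → x ≢ s → x ∈ exchange W s t s?
  ∈exchange⁺ (yes _) x∈W x≢s = x∈p∪q⁺ (inj₁ (x∈p∧x≢y⇒x∈p-y x∈W x≢s))
  ∈exchange⁺ (no _)  x∈W _   = x∈W

  ∈exchange-target : (s? : Dec (s ∈ W)) → s ∈ W → t ∈ exchange W s t s?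
  ∈exchange-target (yes _)  _   = x∈p∪q⁺ (inj₂ (x∈⁅x⁆ t))
  ∈exchange-target (no s∉W) s∈W = contradiction s∈W s∉W

  ∈exchange⁻ : (s? : Dec (s ∈ W)) → x ∈ exchange W s t s? → (x ∈ W × x ≢ s) ⊎ x ≡ t
  ∈exchange⁻ (yes _) x∈ with x∈p∪q⁻ (W - s) ⁅ t ⁆ x∈
  ... | inj₁ x∈W-s = let (x∈W , x∉⁅s⁆) = x∈p─q⁻ W ⁅ s ⁆ x∈W-s in
                     inj₁ (x∈W , λ x≡s → x∉⁅s⁆ (subst (_∈ ⁅ s ⁆) (sym x≡s) (x∈⁅x⁆ s)))
  ... | inj₂ x∈⁅t⁆ = inj₂ (x∈⁅y⁆⇒x≡y t x∈⁅t⁆)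
  ∈exchange⁻ (no s∉W) x∈W = inj₁ (x∈W , λ { refl → s∉W x∈W })

module _ {f : Fin m → Bool} where

  ∈tabulate⁺ : f x ≡ true → x ∈ tabulate f
  ∈tabulate⁺ {x = x} fx = lookup⇒[]= x (tabulate f) (trans (lookup∘tabulate f x) fx)

  ∈tabulate⁻ : x ∈ tabulate f → f x ≡ true
  ∈tabulate⁻ {x = x} x∈ = trans (sym (lookup∘tabulate f x)) ([]=⇒lookup x∈)

module _ {P : Pred (Fin m) 0ℓ} (P? : Decidable P) where

  fromDec : Subset m
  fromDec = tabulate (λ x → does (P? x))

  ∈fromDec⁺ : P x → x ∈ fromDec
  ∈fromDec⁺ {x = x} px = ∈tabulate⁺ (dec-true (P? x) px)

  ∈fromDec⁻ : x ∈ fromDec → P x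
  ∈fromDec⁻ {x = x} x∈ with P? x | ∈tabulate⁻ {x = x} x∈
  ... | yes px | _ = px

  ∈∩fromDec⁺ : x ∈ p → P x → x ∈ p ∩ fromDec
  ∈∩fromDec⁺ x∈p px = x∈p∩q⁺ (x∈p , ∈fromDec⁺ px)

  ∈∩fromDec⁻ : x ∈ p ∩ fromDec → x ∈ p × P x
  ∈∩fromDec⁻ {p = p} x∈ = let (x∈p , x∈P) = x∈p∩q⁻ p fromDec x∈ in x∈p , ∈fromDec⁻ x∈P

  ∈─fromDec⁺ : x ∈ p → ¬ P x → x ∈ p ─ fromDec
  ∈─fromDec⁺ x∈p ¬px = x∈p∧x∉q⇒x∈p─q x∈p λ x∈P → ¬px (∈fromDec⁻ x∈P)

  ∈─fromDec⁻ : x ∈ p ─ fromDec → x ∈ p × ¬ P x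
  ∈─fromDec⁻ {p = p} x∈ = let (x∈p , x∉P) = x∈p─q⁻ p fromDec x∈ in x∈p , λ px → x∉P (∈fromDec⁺ px)

-- Classical reasoning in the double-negation monad

¬¬-Π : {P : Fin m → Set} → (∀ x → ¬ ¬ P x) → ¬ ¬ (∀ x → P x)
¬¬-Π {zero}  _ = pure λ ()
¬¬-Π {suc m} {P} ¬¬p = do
  p₀ ← ¬¬p zero
  pₛ ← ¬¬-Π {P = λ x → P (suc x)} (λ x → ¬¬p (suc x))
  pure λ { zero → p₀ ; (suc x) → pₛ x }

¬¬-→ : {A B : Set} → (A → ¬ ¬ B) → ¬ ¬ (A → B)
¬¬-→ {A} f = ¬¬-excluded-middle {A = A} >>= λ where
  (yes a) → f a >>= λ b → pure λ _ → b
  (no ¬a) → pure λ a → contradiction a ¬a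

¬¬-decidable : (P : Pred (Fin m) 0ℓ) → ¬ ¬ Decidable P
¬¬-decidable P = ¬¬-Π λ _ → ¬¬-excluded-middle

Least : Pred ℕ 0ℓ → ℕ → Set
Least P d = P d × ∀ j → P j → d ≤ j

¬¬-least : (P : Pred ℕ 0ℓ) → P k → ¬ ¬ ∃ (Least P)
¬¬-least P pk = go pk (<-wellFounded _)
  where
  go : ∀ {k} → P k → Acc _<_ k → ¬ ¬ ∃ (Least P)
  go {k} pk (acc smaller) = ¬¬-excluded-middle {A = ∃[ j ] (j < k × P j)} >>= λ where
    (yes (j , j<k , pj)) → go pj (smaller j<k)
    (no ¬smaller)        → pure (k , pk , λ j pj → ≮⇒≥ λ j<k → ¬smaller (j , j<k , pj))

Greatest : (Fin m → ℕ → Set) → Set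
Greatest R = ∃[ c ] ∃[ a ] (R c a × ∀ {c' a'} → R c' a' → a' ≤ a)

¬¬-greatest : (R : Fin m → ℕ → Set) → (∀ {c a b} → R c a → R c b → a ≡ b) →
              ∀ {c a} → R c a → ¬ ¬ Greatest R
¬¬-greatest {suc m} R functional {c₀} r₀ =
  ¬¬-excluded-middle {A = ∃[ c ] ∃ (R (suc c))} >>= λ where
    (no ¬tail) → pure (at-zero ¬tail c₀ r₀)
    (yes (_ , _ , r)) → ¬¬-greatest (λ c → R (suc c)) functional r >>= λ tail →
      ¬¬-excluded-middle {A = ∃ (R zero)} >>= λ where
        (no ¬head)       → pure (in-tail ¬head tail)
        (yes (a₀ , r₀')) → pure (compare a₀ r₀' tail (a₀ ≤? proj₁ (proj₂ tail)))
  where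
  at-zero : ¬ (∃[ c ] ∃ (R (suc c))) → ∀ c {a} → R c a → Greatest R
  at-zero ¬tail zero    r = zero , _ , r , λ { {zero} r' → ≤-reflexive (functional r' r)
                                             ; {suc c'} r' → contradiction (c' , _ , r') ¬tail }
  at-zero ¬tail (suc c) r = contradiction (c , _ , r) ¬tail
  in-tail : ¬ ∃ (R zero) → Greatest (λ c → R (suc c)) → Greatest R
  in-tail ¬head (c , a , r , max) = suc c , a , r , λ { {zero} r' → contradiction (_ , r') ¬head
                                                      ; {suc c'} r' → max r' }
  compare : ∀ a₀ → R zero a₀ → (g : Greatest (λ c → R (suc c))) → Dec (a₀ ≤ proj₁ (proj₂ g)) → Greatest R
  compare a₀ r₀ (c , a , r , max) (yes a₀≤a) =
    suc c , a , r , λ { {zero} r' → ≤-trans (≤-reflexive (functional r' r₀)) a₀≤a ; {suc c'} r' → max r' }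
  compare a₀ r₀ (c , a , r , max) (no a₀≰a) =
    zero , a₀ , r₀ , λ { {zero} r' → ≤-reflexive (functional r' r₀)
                       ; {suc c'} r' → ≤-trans (max r') (<⇒≤ (≰⇒> a₀≰a)) }

-- Walks, distances and isometric subgraphs

module _ {n : ℕ} (G : Graph n) where

  private
    variable
      S T C D : VSet G
      W W₁ W₂ W' : Subset n
      a b c d u v w w' : Fin n
      i j : ℕ

  Edge-sym : Edge G u v → Edge G v u
  Edge-sym {u} {v} uv = trans (Graph.sym G v u) uv

  Edge-irrefl : ¬ Edge G u u
  Edge-irrefl {u} = not-¬ (irrefl G u)

  source∈ : Walk G S u v k → S u
  source∈ (stop su)     = su
  source∈ (step su _ _) = su

  target∈ : Walk G S u v k → S v
  target∈ (stop sv)    = sv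
  target∈ (step _ _ w) = target∈ w

  infixr 5 _++ʷ_
  _++ʷ_ : Walk G S u w j → Walk G S w v k → Walk G S u v (j + k)
  stop _      ++ʷ w' = w'
  step s e w  ++ʷ w' = step s e (w ++ʷ w')

  snocʷ : Walk G S u w k → Edge G w v → S v → Walk G S u v (suc k)
  snocʷ {k = k} w e sv = subst (Walk G _ _ _) (+-comm k 1) (w ++ʷ step (target∈ w) e (stop sv))

  reverseʷ : Walk G S u v k → Walk G S v u k
  reverseʷ (stop s)     = stop s
  reverseʷ (step s e w) = snocʷ (reverseʷ w) (Edge-sym e) s

  mapʷ : S ⊆ T → Walk G S u v k → Walk G T u v k
  mapʷ S⊆T (stop s)     = stop (S⊆T s)
  mapʷ S⊆T (step s e w) = step (S⊆T s) e (mapʷ S⊆T w)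

  first-step : Walk G S a c k → c ≢ a → ∃[ w ] ∃[ k' ] (k ≡ suc k' × Edge G a w × Walk G S w c k')
  first-step (stop _)          c≢a = contradiction refl c≢a
  first-step (step _ a~w rest) _   = _ , _ , refl , a~w , rest

  Closed : VSet G → VSet G → Set
  Closed S C = ∀ x y → C x → S y → Edge G x y → C y

  Closed-⊆ : T ⊆ S → Closed S C → Closed T C
  Closed-⊆ T⊆S closed x y cx ty = closed x y cx (T⊆S ty)

  Reach : VSet G → Fin n → VSet G
  Reach S a b = ∃ (Walk G S a b)

  Reach-closed : Closed S (Reach S a)
  Reach-closed _ _ (k , w) sy e = suc k , snocʷ w e sy

  restrictʷ : Closed S C → C u → Walk G S u v k → Walk G C u v k
  restrictʷ closed cu (stop _)     = stop cu
  restrictʷ closed cu (step _ e w) = step cu e (restrictʷ closed (closed _ _ cu (source∈ w) e) w)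

  Dist-unique : Dist G S u v i → Dist G S u v j → i ≡ j
  Dist-unique (wi , least-i) (wj , least-j) = ≤-antisym (least-i _ wj) (least-j _ wi)

  ¬¬-Dist : Walk G S u v k → ¬ ¬ ∃ (Dist G S u v)
  ¬¬-Dist w = ¬¬-least _ w

  AllDist : VSet G → Set
  AllDist S = ∀ u v → ∃ (Walk G S u v) → ∃ (Dist G S u v)

  ¬¬-AllDist : ∀ S → ¬ ¬ AllDist S
  ¬¬-AllDist S = ¬¬-Π λ u → ¬¬-Π λ v → ¬¬-→ λ (_ , w) → ¬¬-Dist w

  StronglyResolves-sym : StronglyResolves G S w u v → StronglyResolves G S w v u
  StronglyResolves-sym (inj₁ g) = inj₂ g
  StronglyResolves-sym (inj₂ g) = inj₁ g

  resolver-walk : StronglyResolves G S w u v → ∃ (Walk G S w u)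
  resolver-walk (inj₁ (i , _ , _ , wu , _))      = i , wu
  resolver-walk (inj₂ (i , j , _ , wv , vu , _)) = i + j , wv ++ʷ vu

  record Isometric (T S : VSet G) : Set where
    field
      T⊆S      : T ⊆ S
      shortcut : T a → T b → Walk G S a b k → ∃[ k' ] (k' ≤ k × Walk G T a b k')

    Dist⁺ : Dist G T u v i → Dist G S u v i
    Dist⁺ (w , least) = mapʷ T⊆S w , λ k w' →
      let (k' , k'≤k , w'') = shortcut (source∈ w) (target∈ w) w' in ≤-trans (least k' w'') k'≤k

    Dist⁻ : T u → T v → Dist G S u v i → Dist G T u v i
    Dist⁻ {u} {v} tu tv (w , least) =
      let (k' , k'≤d , w') = shortcut tu tv w in
      subst (Walk G T u v) (≤-antisym k'≤d (least k' (mapʷ T⊆S w'))) w' , λ k w'' → least k (mapʷ T⊆S w'')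

    OnGeodesic⁺ : OnGeodesic G T w u v → OnGeodesic G S w u v
    OnGeodesic⁺ (i , j , d , wu , uv , dist , i+j≡d) = i , j , d , mapʷ T⊆S wu , mapʷ T⊆S uv , Dist⁺ dist , i+j≡d

    OnGeodesic⁻ : T w → T u → T v → OnGeodesic G S w u v → OnGeodesic G T w u v
    OnGeodesic⁻ tw tu tv (i , j , d , wu , uv , dist , i+j≡d) =
      let (i' , i'≤i , wu') = shortcut tw tu wu
          (j' , j'≤j , uv') = shortcut tu tv uv
      in i' , j' , d , wu' , uv' , Dist⁻ tw tv dist ,
         ≤-antisym (subst (i' + j' ≤_) i+j≡d (+-mono-≤ i'≤i j'≤j)) (proj₂ dist _ (mapʷ T⊆S (wu' ++ʷ uv')))

    resolves⁺ : StronglyResolves G T w u v → StronglyResolves G S w u v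
    resolves⁺ (inj₁ g) = inj₁ (OnGeodesic⁺ g)
    resolves⁺ (inj₂ g) = inj₂ (OnGeodesic⁺ g)

    resolves⁻ : T w → T u → T v → StronglyResolves G S w u v → StronglyResolves G T w u v
    resolves⁻ tw tu tv (inj₁ g) = inj₁ (OnGeodesic⁻ tw tu tv g)
    resolves⁻ tw tu tv (inj₂ g) = inj₂ (OnGeodesic⁻ tw tv tu g)

  closed⇒isometric : C ⊆ S → Closed S C → Isometric C S
  closed⇒isometric C⊆S closed = record { T⊆S = C⊆S ; shortcut = λ ca _ w → _ , ≤-refl , restrictʷ closed ca w }

  -- Resolving sets and the additivity of sdim

  Closed-∖ : Closed S C → Closed S (S ∖ C)
  Closed-∖ closed x y (sx , ¬cx) sy e = sy , λ cy → ¬cx (closed y x cy sx (Edge-sym e))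

  record Resolving (S : VSet G) (W : Subset n) : Set where
    field
      W⊆S      : w ∈ W → S w
      resolves : S u → S v → u ≢ v → ∃ (Walk G S u v) → ∃[ w ] (w ∈ W × StronglyResolves G S w u v)

  strongResolving⇒resolving : StrongResolvingSet G S W → Resolving S W
  strongResolving⇒resolving (W⊆S , res) = record
    { W⊆S = W⊆S _ ; resolves = λ su sv u≢v _ → res _ _ su sv u≢v }

  resolving⇒strongResolving : Connected G S → Resolving S W → StrongResolvingSet G S W
  resolving⇒strongResolving connected res =
    (λ _ → W⊆S) , λ u v su sv u≢v → resolves su sv u≢v (connected u v su sv)
    where open Resolving res

  resolve-in-closed : C ⊆ S → Closed S C → Resolving C W → C u → Walk G S u v k → u ≢ v →
                      ∃[ w ] (w ∈ W × StronglyResolves G S w u v)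
  resolve-in-closed C⊆S closed res cu uv u≢v =
    let uv' = restrictʷ closed cu uv
        (w , w∈W , r) = Resolving.resolves res cu (target∈ uv') u≢v (_ , uv')
    in w , w∈W , Isometric.resolves⁺ (closed⇒isometric C⊆S closed) r

  resolving-∪ : C ⊆ S → D ⊆ S → Closed S C → Closed S D → (∀ {x} → S x → C x ⊎ D x) →
                Resolving C W₁ → Resolving D W₂ → Resolving S (W₁ ∪ W₂)
  resolving-∪ {W₁ = W₁} {W₂ = W₂} C⊆S D⊆S closedC closedD split resC resD = record
    { W⊆S      = λ w∈ → case x∈p∪q⁻ W₁ W₂ w∈ of λ where
                   (inj₁ w∈W₁) → C⊆S (Resolving.W⊆S resC w∈W₁)
                   (inj₂ w∈W₂) → D⊆S (Resolving.W⊆S resD w∈W₂)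
    ; resolves = λ su _ u≢v (_ , uv) → case split su of λ where
                   (inj₁ cu) → let (w , w∈ , r) = resolve-in-closed C⊆S closedC resC cu uv u≢v
                               in w , x∈p∪q⁺ (inj₁ w∈) , r
                   (inj₂ du) → let (w , w∈ , r) = resolve-in-closed D⊆S closedD resD du uv u≢v
                               in w , x∈p∪q⁺ (inj₂ w∈) , r
    }

  resolving-restrict : C ⊆ S → Closed S C → Resolving S W →
                       (∀ {w} → w ∈ W → C w → w ∈ W') → (∀ {w} → w ∈ W' → C w) → Resolving C W'
  resolving-restrict C⊆S closed res keep W'⊆C = record
    { W⊆S      = W'⊆C
    ; resolves = λ cu cv u≢v (_ , uv) →
        let (w , w∈W , r) = Resolving.resolves res (C⊆S cu) (C⊆S cv) u≢v (_ , mapʷ C⊆S uv)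
            cw = target∈ (restrictʷ closed cu (reverseʷ (proj₂ (resolver-walk r))))
        in w , keep w∈W cw , Isometric.resolves⁻ (closed⇒isometric C⊆S closed) cw cu cv r
    }

  record MinResolving (S : VSet G) (size : ℕ) : Set where
    field
      basis     : Subset n
      resolving : Resolving S basis
      small     : ∣ basis ∣ ≤ size
      minimal   : Resolving S W → size ≤ ∣ W ∣

  minResolving-comp : Component G S C → SdimConn G C i → MinResolving (S ∖ C) j → Decidable C →
                      MinResolving S (i + j)
  minResolving-comp {S = S} {C = C} {i = i} {j = j} (C⊆S , _ , connected , closed)
                    (_ , (W₁ , srs , ∣W₁∣≡i) , minimal₁) rest C? = record
    { basis     = W₁ ∪ basis
    ; resolving = resolving-∪ (C⊆S _) proj₁ closed (Closed-∖ closed) split (strongResolving⇒resolving srs) resolving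
    ; small     = ≤-trans (∣p∪q∣≤∣p∣+∣q∣ W₁ basis) (+-mono-≤ (≤-reflexive ∣W₁∣≡i) small)
    ; minimal   = λ {W} res → subst (i + j ≤_) (sym (∣p∣≡∣p∩q∣+∣p─q∣ W (fromDec C?)))
        (+-mono-≤ (minimal₁ _ (resolving⇒strongResolving connected
                    (resolving-restrict (C⊆S _) closed res (∈∩fromDec⁺ C?) (λ w∈ → proj₂ (∈∩fromDec⁻ C? w∈)))))
                  (minimal (resolving-restrict proj₁ (Closed-∖ closed) res
                    (λ w∈ (_ , ¬cw) → ∈─fromDec⁺ C? w∈ ¬cw)
                    (λ w∈ → let (w∈W , ¬cw) = ∈─fromDec⁻ C? w∈ in Resolving.W⊆S res w∈W , ¬cw))))
    }
    where
    open MinResolving rest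
    split : S u → C u ⊎ (S ∖ C) u
    split {u} su with C? u
    ... | yes cu = inj₁ cu
    ... | no ¬cu = inj₂ (su , ¬cu)

  ¬¬-minResolving : Sdim G S i → ¬ ¬ MinResolving S i
  ¬¬-minResolving (none empty) = pure record
    { basis     = ∅
    ; resolving = record { W⊆S = λ w∈⊥ → contradiction w∈⊥ ∉⊥ ; resolves = λ su → contradiction su (empty _) }
    ; small     = ≤-reflexive (∣⊥∣≡0 n)
    ; minimal   = λ _ → z≤n
    }
  ¬¬-minResolving (comp {C = C} component sdimC rest) = do
    minRest ← ¬¬-minResolving rest
    C? ← ¬¬-decidable C
    pure (minResolving-comp component sdimC minRest C?)

  -- Isolated paths

  resolving-nonempty : Resolving S W → S u → S v → u ≢ v → ∃ (Walk G S u v) → 0 < ∣ W ∣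
  resolving-nonempty res su sv u≢v uv = x∈p⇒0<∣p∣ (proj₁ (proj₂ (Resolving.resolves res su sv u≢v uv)))

  module PathEndpoint {P : VSet G} {len : ℕ} (p : Fin (suc len) → Fin n) (p-injective : Injective _≡_ _≡_ p)
    (p∈P : ∀ s → P (p s)) (p-onto : ∀ x → P x → ∃[ s ] p s ≡ x)
    (p-adj : ∀ s t → (Edge G (p s) (p t) → (toℕ t ≡ suc (toℕ s) ⊎ toℕ s ≡ suc (toℕ t))) ×
                     ((toℕ t ≡ suc (toℕ s) ⊎ toℕ s ≡ suc (toℕ t)) → Edge G (p s) (p t)))
    where

    index-bound : Walk G P a b k → ∀ s t → p s ≡ a → p t ≡ b → toℕ t ≤ toℕ s + k
    index-bound (stop _) s t refl pt≡ps = ≤-trans (≤-reflexive (cong toℕ (p-injective pt≡ps))) (m≤m+n _ 0)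
    index-bound {k = suc k} (step {w = w} _ e rest) s t refl pt≡b with p-onto w (source∈ rest)
    ... | r , refl =
      ≤-trans (index-bound rest r t refl pt≡b)
              (≤-trans (+-monoˡ-≤ k (r≤s+1 r e)) (≤-reflexive (sym (+-suc (toℕ s) k))))
      where
      r≤s+1 : ∀ r → Edge G (p s) (p r) → toℕ r ≤ suc (toℕ s)
      r≤s+1 r e with proj₁ (p-adj s r) e
      ... | inj₁ r≡s+1 = ≤-reflexive r≡s+1
      ... | inj₂ s≡r+1 = ≤-trans (n≤1+n _) (≤-trans (≤-reflexive (sym s≡r+1)) (n≤1+n _))

    walk-along : ∀ k s t → toℕ t ≡ toℕ s + k → Walk G P (p s) (p t) k
    walk-along zero    s t t≡s = subst (λ t → Walk G P (p s) (p t) 0)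
                                       (toℕ-injective (trans (sym (+-identityʳ _)) (sym t≡s))) (stop (p∈P s))
    walk-along (suc k) s t t≡s+k+1 = snocʷ (walk-along k s r (toℕ-fromℕ< r<len)) r~t (p∈P t)
      where
      r<len : toℕ s + k < suc len
      r<len = <-trans (≤-trans (+-monoʳ-< (toℕ s) (n<1+n k)) (≤-reflexive (sym t≡s+k+1))) (toℕ<n t)
      r = fromℕ< r<len
      r~t : Edge G (p r) (p t)
      r~t = proj₂ (p-adj r t) (inj₁ (trans t≡s+k+1 (trans (+-suc (toℕ s) k) (cong suc (sym (toℕ-fromℕ< r<len))))))

    endpoint-geodesic : ∀ s t → toℕ s ≤ toℕ t → OnGeodesic G P (p zero) (p s) (p t)
    endpoint-geodesic s t s≤t =
      toℕ s , toℕ t ∸ toℕ s , toℕ t , walk-along (toℕ s) zero s refl ,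
      walk-along _ s t (sym (m+[n∸m]≡n s≤t)) ,
      (walk-along (toℕ t) zero t refl , λ _ w → index-bound w zero t refl refl) , m+[n∸m]≡n s≤t

    endpoint-resolving : Resolving P ⁅ p zero ⁆
    endpoint-resolving = record
      { W⊆S      = λ w∈ → subst P (sym (x∈⁅y⁆⇒x≡y _ w∈)) (p∈P zero)
      ; resolves = λ pu pv _ _ → p zero , x∈⁅x⁆ _ , resolves pu pv
      }
      where
      resolves : P u → P v → StronglyResolves G P (p zero) u v
      resolves {u} {v} pu pv with p-onto u pu | p-onto v pv
      ... | s , refl | t , refl with toℕ s ≤? toℕ t
      ...   | yes s≤t = inj₁ (endpoint-geodesic s t s≤t)
      ...   | no s≰t  = inj₂ (endpoint-geodesic t s (<⇒≤ (≰⇒> s≰t)))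

  sdim-isolatedPath : ∀ {P} → IsolatedPath G P → Sdim G (∁ P) i → Sdim G (All G) j → suc i ≡ j
  sdim-isolatedPath {i = i} {j = j} {P = P}
    ((_ , _ , connected , closedP) , (_ , p , p-injective , p∈P , p-onto , p-adj) , x₀ , y₀ , px₀ , py₀ , x₀≢y₀)
    sdim∁P sdimG =
    decidable-stable (suc i ≟ℕ j) do
      min∁P ← ¬¬-minResolving sdim∁P
      minG  ← ¬¬-minResolving sdimG
      P?    ← ¬¬-decidable P
      pure (≤-antisym (lower min∁P minG P?) (upper min∁P minG P?))
    where
    open PathEndpoint p p-injective p∈P p-onto p-adj using (endpoint-resolving)
    closed∁P : Closed (All G) (∁ P)
    closed∁P x y ¬px _ e py = ¬px (closedP y x py tt (Edge-sym e))

    upper : MinResolving (∁ P) i → MinResolving (All G) j → Decidable P → j ≤ suc i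
    upper min∁P minG P? =
      ≤-trans (MinResolving.minimal minG (resolving-∪ _ _ closedP closed∁P split endpoint-resolving resolving))
              (≤-trans (∣p∪q∣≤∣p∣+∣q∣ ⁅ p zero ⁆ basis) (+-mono-≤ (≤-reflexive (∣⁅x⁆∣≡1 (p zero))) small))
      where
      open MinResolving min∁P
      split : ∀ {x} → All G x → P x ⊎ ∁ P x
      split {x} _ with P? x
      ... | yes px = inj₁ px
      ... | no ¬px = inj₂ ¬px

    lower : MinResolving (∁ P) i → MinResolving (All G) j → Decidable P → suc i ≤ j
    lower min∁P minG P? =
      ≤-trans (subst (suc i ≤_) (sym (∣p∣≡∣p∩q∣+∣p─q∣ basis (fromDec P?)))
                (+-mono-≤ (resolving-nonempty resP px₀ py₀ x₀≢y₀ (connected x₀ y₀ px₀ py₀))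
                          (MinResolving.minimal min∁P res∁P)))
              small
      where
      open MinResolving minG
      resP : Resolving P (basis ∩ fromDec P?)
      resP = resolving-restrict _ closedP resolving (∈∩fromDec⁺ P?) (λ w∈ → proj₂ (∈∩fromDec⁻ P? w∈))
      res∁P : Resolving (∁ P) (basis ─ fromDec P?)
      res∁P = resolving-restrict _ closed∁P resolving (∈─fromDec⁺ P?) (λ w∈ → proj₂ (∈─fromDec⁻ P? w∈))

  -- Peripheral leaves

  module PeripheralLeafAt {ℓ u : Fin n} (deg-ℓ : deg G ℓ ≡ 1) (ℓ~u : Edge G ℓ u) (deg-u : deg G u ≡ 2) where

    private
      M = minus G ℓ
      A = All G

    ℓ-neighbour : Edge G ℓ w → w ≡ u
    ℓ-neighbour ℓ~w = ∣p∣≤1⇒x≡y (≤-reflexive deg-ℓ) (∈tabulate⁺ ℓ~w) (∈tabulate⁺ ℓ~u)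

    u≢ℓ : u ≢ ℓ
    u≢ℓ u≡ℓ = Edge-irrefl (subst (Edge G ℓ) u≡ℓ ℓ~u)

    u-neighbour-unique : Edge G u w → Edge G u w' → w ≢ ℓ → w' ≢ ℓ → w ≡ w'
    u-neighbour-unique u~w u~w' w≢ℓ w'≢ℓ =
      ∣p∣≤2⇒y≡z (≤-reflexive deg-u) (∈tabulate⁺ (Edge-sym ℓ~u)) (∈tabulate⁺ u~w) (∈tabulate⁺ u~w')
                (≢-sym w≢ℓ) (≢-sym w'≢ℓ)

    u-other-neighbour : ∃[ w ] (Edge G u w × w ≢ ℓ)
    u-other-neighbour =
      let (w , w∈ , w≢ℓ) = 1<∣p∣⇒∃≢ (≤-reflexive (sym deg-u)) ℓ in w , ∈tabulate⁻ w∈ , w≢ℓ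

    avoid-ℓ : a ≢ ℓ → b ≢ ℓ → Walk G A a b k → ∃[ k' ] (k' ≤ k × Walk G M a b k')
    avoid-ℓ a≢ℓ b≢ℓ (stop _) = 0 , z≤n , stop a≢ℓ
    avoid-ℓ a≢ℓ b≢ℓ (step {w = w} _ a~w rest) with w ≟ ℓ
    ... | no w≢ℓ = let (k' , k'≤ , rest') = avoid-ℓ w≢ℓ b≢ℓ rest in suc k' , s≤s k'≤ , step a≢ℓ a~w rest'
    avoid-ℓ a≢ℓ b≢ℓ (step _ a~ℓ (stop _)) | yes refl = contradiction refl b≢ℓ
    avoid-ℓ {b = b} a≢ℓ b≢ℓ (step _ a~ℓ (step _ ℓ~w rest)) | yes refl =
      -- both a and the vertex after ℓ are neighbours of ℓ, hence both are u
      let (k' , k'≤ , rest') = avoid-ℓ (λ w≡ℓ → u≢ℓ (trans (sym (ℓ-neighbour ℓ~w)) w≡ℓ)) b≢ℓ rest in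
      k' , ≤-trans k'≤ (≤-trans (n≤1+n _) (n≤1+n _)) ,
      subst (λ x → Walk G M x b k') (trans (ℓ-neighbour ℓ~w) (sym (ℓ-neighbour (Edge-sym a~ℓ)))) rest'

    minus-isometric : Isometric M A
    minus-isometric = record { T⊆S = λ _ → tt ; shortcut = avoid-ℓ }

    open Isometric minus-isometric using (resolves⁺; resolves⁻)

    leave-ℓ : Walk G A ℓ c k → c ≢ ℓ → ∃[ k' ] (k ≡ suc k' × Walk G A u c k')
    leave-ℓ (stop _)        c≢ℓ = contradiction refl c≢ℓ
    leave-ℓ (step _ ℓ~w rest) _ = _ , refl , subst (λ w → Walk G A w _ _) (ℓ-neighbour ℓ~w) rest

    geodesic-from-u : OnGeodesic G A ℓ c d → c ≢ ℓ → d ≢ ℓ → OnGeodesic G A u c d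
    geodesic-from-u (i , j , δ , ℓc , cd , (ℓd , least) , i+j≡δ) c≢ℓ d≢ℓ with leave-ℓ ℓc c≢ℓ | leave-ℓ ℓd d≢ℓ
    ... | i' , refl , uc | δ' , refl , ud =
      i' , j , δ' , uc , cd , (ud , λ k w → ≤-pred (least (suc k) (step tt ℓ~u w))) , suc-injective i+j≡δ

    geodesic-from-ℓ : OnGeodesic G A u c d → d ≢ ℓ → OnGeodesic G A ℓ c d
    geodesic-from-ℓ (i , j , δ , uc , cd , (ud , least) , i+j≡δ) d≢ℓ =
      suc i , j , suc δ , step tt ℓ~u uc , cd ,
      (step tt ℓ~u ud , λ k w → let (k' , k≡ , uw) = leave-ℓ w d≢ℓ in subst (suc δ ≤_) (sym k≡) (s≤s (least k' uw))) ,
      cong suc i+j≡δ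

    resolves-from-u : StronglyResolves G A ℓ c d → c ≢ ℓ → d ≢ ℓ → StronglyResolves G A u c d
    resolves-from-u (inj₁ g) c≢ℓ d≢ℓ = inj₁ (geodesic-from-u g c≢ℓ d≢ℓ)
    resolves-from-u (inj₂ g) c≢ℓ d≢ℓ = inj₂ (geodesic-from-u g d≢ℓ c≢ℓ)

    resolves-from-ℓ : StronglyResolves G A u c d → c ≢ ℓ → d ≢ ℓ → StronglyResolves G A ℓ c d
    resolves-from-ℓ (inj₁ g) c≢ℓ d≢ℓ = inj₁ (geodesic-from-ℓ g d≢ℓ)
    resolves-from-ℓ (inj₂ g) c≢ℓ d≢ℓ = inj₂ (geodesic-from-ℓ g c≢ℓ)

    Dist-through-u : w ≢ ℓ → Dist G M w u i → Dist G A w ℓ (suc i)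
    Dist-through-u {w} {i} w≢ℓ (wu , least) = snocʷ (mapʷ _ wu) (Edge-sym ℓ~u) tt , λ k wℓ →
      let (k' , k≡ , uw) = leave-ℓ (reverseʷ wℓ) w≢ℓ
          (k'' , k''≤ , uw') = avoid-ℓ u≢ℓ w≢ℓ uw
      in subst (suc i ≤_) (sym k≡) (s≤s (≤-trans (least k'' (reverseʷ uw')) k''≤))

    -- in G - ℓ the vertex u has a single neighbour, so a geodesic cannot pass through it
    u-not-interior : OnGeodesic G M w u d → w ≢ u → d ≢ u → ⊥
    u-not-interior (i , j , δ , wu , ud , (wd , least) , i+j≡δ) w≢u d≢u
      with first-step (reverseʷ wu) w≢u | first-step ud d≢u
    ... | z₁ , i' , refl , u~z₁ , z₁w | z₂ , j' , refl , u~z₂ , z₂d =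
      1+n≰n (≤-trans (n≤1+n _) (subst (_≤ i' + j') (trans (sym i+j≡δ) (cong suc (+-suc i' j')))
        (least _ (reverseʷ z₁w ++ʷ subst (λ z → Walk G M z _ j')
                   (sym (u-neighbour-unique u~z₁ u~z₂ (source∈ z₁w) (source∈ z₂d))) z₂d))))

    resolving-minus-ℓ : Resolving A W → Resolving M (exchange W ℓ u (ℓ ∈? W))
    resolving-minus-ℓ {W} res = record
      { W⊆S      = λ x∈ → case ∈exchange⁻ ℓ? x∈ of λ where
                     (inj₁ (_ , x≢ℓ)) → x≢ℓ
                     (inj₂ refl)      → u≢ℓ
      ; resolves = λ c≢ℓ d≢ℓ c≢d (_ , cd) →
          let (x , x∈ , r) = Resolving.resolves res tt tt c≢d (_ , mapʷ _ cd) in relocate x∈ r c≢ℓ d≢ℓ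
      }
      where
      ℓ? = ℓ ∈? W
      relocate : x ∈ W → StronglyResolves G A x c d → c ≢ ℓ → d ≢ ℓ →
                 ∃[ y ] (y ∈ exchange W ℓ u ℓ? × StronglyResolves G M y c d)
      relocate {x} x∈ r c≢ℓ d≢ℓ with x ≟ ℓ
      ... | no x≢ℓ   = x , ∈exchange⁺ ℓ? x∈ x≢ℓ , resolves⁻ x≢ℓ c≢ℓ d≢ℓ r
      ... | yes refl = u , ∈exchange-target ℓ? x∈ , resolves⁻ u≢ℓ c≢ℓ d≢ℓ (resolves-from-u r c≢ℓ d≢ℓ)

    resolve-from-ℓ : Resolving M W → AllDist A → AllDist M → (u? : Dec (u ∈ W)) → d ≢ ℓ → Walk G A ℓ d k →
                     ∃[ x ] (x ∈ exchange W u ℓ u? × StronglyResolves G A x ℓ d)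
    resolve-from-ℓ {d = d} res distA distM u?@(yes u∈) d≢ℓ ℓd =
      let (δ , dist) = distA ℓ d (_ , ℓd) in
      ℓ , ∈exchange-target u? u∈ , inj₁ (0 , δ , δ , stop tt , proj₁ dist , dist , refl)
    resolve-from-ℓ {W} {d} res distA distM (no u∉) d≢ℓ ℓd with d ≟ u
    ... | yes refl =
      -- any resolver of u and its other neighbour sees u on its geodesic to ℓ
      let (w , u~w , w≢ℓ) = u-other-neighbour
          (x , x∈ , r) = Resolving.resolves res u≢ℓ w≢ℓ (λ u≡w → Edge-irrefl (subst (Edge G u) (sym u≡w) u~w))
                                            (1 , step u≢ℓ u~w (stop w≢ℓ))
          (_ , xu) = resolver-walk r
          (δ , dist) = distM x u (_ , xu)
      in x , x∈ ,
         inj₂ (δ , 1 , suc δ , mapʷ _ (proj₁ dist) , step tt (Edge-sym ℓ~u) (stop tt) ,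
               Dist-through-u (source∈ xu) dist , +-comm δ 1)
    ... | no d≢u =
      let (_ , _ , ud) = leave-ℓ ℓd d≢ℓ
          (_ , _ , ud') = avoid-ℓ u≢ℓ d≢ℓ ud
          (x , x∈ , r) = Resolving.resolves res u≢ℓ d≢ℓ (≢-sym d≢u) (_ , ud')
          x≢u = λ x≡u → u∉ (subst (_∈ W) x≡u x∈)
      in x , x∈ , extend x≢u r
      where
      extend : x ≢ u → StronglyResolves G M x u d → StronglyResolves G A x ℓ d
      extend x≢u (inj₁ g) = ⊥-elim (u-not-interior g x≢u d≢u)
      extend x≢u (inj₂ (i , j , δ , xd , du , dist , i+j≡δ)) =
        inj₂ (i , suc j , suc δ , mapʷ _ xd , snocʷ (mapʷ _ du) (Edge-sym ℓ~u) tt ,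
              Dist-through-u (source∈ xd) dist , trans (+-suc i j) (cong suc i+j≡δ))

    resolving-with-ℓ : Resolving M W → AllDist A → AllDist M → Resolving A (exchange W u ℓ (u ∈? W))
    resolving-with-ℓ {W} res distA distM = record
      { W⊆S      = λ _ → tt
      ; resolves = λ {c} {d} _ _ c≢d (_ , cd) → case (c ≟ ℓ) ,′ (d ≟ ℓ) of λ where
          (yes refl , yes refl) → contradiction refl c≢d
          (yes refl , no d≢ℓ)   → resolve-from-ℓ res distA distM u? d≢ℓ cd
          (no c≢ℓ , yes refl)   → let (x , x∈ , r) = resolve-from-ℓ res distA distM u? c≢ℓ (reverseʷ cd) in
                                  x , x∈ , StronglyResolves-sym r
          (no c≢ℓ , no d≢ℓ)     →
            let (_ , _ , cd') = avoid-ℓ c≢ℓ d≢ℓ cd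
                (x , x∈ , r) = Resolving.resolves res c≢ℓ d≢ℓ c≢d (_ , cd')
            in relocate x∈ r c≢ℓ d≢ℓ
      }
      where
      u? = u ∈? W
      relocate : x ∈ W → StronglyResolves G M x c d → c ≢ ℓ → d ≢ ℓ →
                 ∃[ y ] (y ∈ exchange W u ℓ u? × StronglyResolves G A y c d)
      relocate {x} x∈ r c≢ℓ d≢ℓ with x ≟ u
      ... | no x≢u   = x , ∈exchange⁺ u? x∈ x≢u , resolves⁺ r
      ... | yes refl = ℓ , ∈exchange-target u? x∈ , resolves-from-ℓ (resolves⁺ r) c≢ℓ d≢ℓ

  sdim-minus-peripheralLeaf : ∀ {ℓ} → PeripheralLeaf G ℓ → Sdim G (minus G ℓ) i → Sdim G (All G) j → i ≡ j
  sdim-minus-peripheralLeaf {i = i} {j = j} {ℓ} (deg-ℓ , u , ℓ~u , deg-u) sdimM sdimA =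
    decidable-stable (i ≟ℕ j) do
      minM  ← ¬¬-minResolving sdimM
      minA  ← ¬¬-minResolving sdimA
      distA ← ¬¬-AllDist (All G)
      distM ← ¬¬-AllDist (minus G ℓ)
      let open MinResolving
      pure (≤-antisym
        (≤-trans (minimal minM (resolving-minus-ℓ (resolving minA))) (≤-trans (∣exchange∣≤∣W∣ (ℓ ∈? basis minA)) (small minA)))
        (≤-trans (minimal minA (resolving-with-ℓ (resolving minM) distA distM))
                 (≤-trans (∣exchange∣≤∣W∣ (u ∈? basis minM)) (small minM))))
    where open PeripheralLeafAt deg-ℓ ℓ~u deg-u

  -- Vertices on no cycle

  vertexAt : Walk G S a b k → Fin (suc k) → Fin n
  vertexAt {a = a} _ zero    = a
  vertexAt (step _ _ w) (suc i) = vertexAt w i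
  vertexAt (stop _)     (suc ())

  vertexAt-last : (w : Walk G S a b k) → vertexAt w (fromℕ k) ≡ b
  vertexAt-last (stop _)     = refl
  vertexAt-last (step _ _ w) = vertexAt-last w

  vertexAt-edge : (w : Walk G S a b k) (i : Fin k) → Edge G (vertexAt w (inject₁ i)) (vertexAt w (suc i))
  vertexAt-edge (step _ e _) zero    = e
  vertexAt-edge (step _ _ w) (suc i) = vertexAt-edge w i

  vertexAt∈ : (w : Walk G S a b k) (i : Fin (suc k)) → S (vertexAt w i)
  vertexAt∈ w            zero    = source∈ w
  vertexAt∈ (step _ _ w) (suc i) = vertexAt∈ w i

  prefixʷ : (w : Walk G S a b k) (i : Fin (suc k)) → Walk G S a (vertexAt w i) (toℕ i)
  prefixʷ w            zero    = stop (source∈ w)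
  prefixʷ (step s e w) (suc i) = step s e (prefixʷ w i)

  suffixʷ : (w : Walk G S a b k) (i : Fin (suc k)) → Walk G S (vertexAt w i) b (k ∸ toℕ i)
  suffixʷ w            zero    = w
  suffixʷ (step _ _ w) (suc i) = suffixʷ w i

  Shortest : Walk G S a b k → Set
  Shortest {S = S} {a = a} {b = b} {k = k} _ = ∀ j → Walk G S a b j → k ≤ j

  shortest-no-repeat : (w : Walk G S a b k) → Shortest w → ∀ {i j} → toℕ i < toℕ j → vertexAt w i ≢ vertexAt w j
  shortest-no-repeat w shortest {i} {j} i<j eq =
    <⇒≱ shorter (shortest _ (prefixʷ w i ++ʷ subst (λ z → Walk G _ z _ _) (sym eq) (suffixʷ w j)))
    where
    shorter : toℕ i + (_ ∸ toℕ j) < _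
    shorter = ≤-trans (+-monoˡ-≤ _ i<j) (≤-reflexive (m+[n∸m]≡n (≤-pred (toℕ<n j))))

  shortest-injective : (w : Walk G S a b k) → Shortest w → Injective _≡_ _≡_ (vertexAt w)
  shortest-injective w shortest {i} {j} eq with <-cmp (toℕ i) (toℕ j)
  ... | tri< i<j _ _ = contradiction eq (shortest-no-repeat w shortest i<j)
  ... | tri≈ _ i≡j _ = toℕ-injective i≡j
  ... | tri> _ _ j<i = contradiction (sym eq) (shortest-no-repeat w shortest j<i)

  cycle-through : Edge G v a → Edge G v b → (w : Walk G (minus G v) a b (suc k)) → Shortest w → Cycle G
  cycle-through {v} {k = k} v~a v~b w shortest =
    record { m = k ; vert = vert ; inj = inj ; consec = consec ; closing = closing }
    where
    vert : Fin (suc (suc (suc k))) → Fin n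
    vert zero    = v
    vert (suc i) = vertexAt w i
    inj : Injective _≡_ _≡_ vert
    inj {zero}  {zero}  _  = refl
    inj {zero}  {suc j} eq = contradiction (sym eq) (vertexAt∈ w j)
    inj {suc i} {zero}  eq = contradiction eq (vertexAt∈ w i)
    inj {suc i} {suc j} eq = cong suc (shortest-injective w shortest eq)
    consec : ∀ i → Edge G (vert (inject₁ i)) (vert (suc i))
    consec zero    = v~a
    consec (suc i) = vertexAt-edge w i
    closing : Edge G (vert (fromℕ (suc (suc k)))) v
    closing = subst (λ z → Edge G z v) (sym (vertexAt-last w)) (Edge-sym v~b)

  CycEdge⇒OnCycle : ∀ {C} → CycEdge G C v w → OnCycle G C v
  CycEdge⇒OnCycle (inj₁ (inj₁ (i , v≡ , _))) = inject₁ i , sym v≡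
  CycEdge⇒OnCycle (inj₁ (inj₂ (v≡ , _)))     = _ , sym v≡
  CycEdge⇒OnCycle (inj₂ (inj₁ (i , _ , v≡))) = suc i , sym v≡
  CycEdge⇒OnCycle (inj₂ (inj₂ (_ , v≡)))     = zero , sym v≡

  Separating : Fin n → Set
  Separating v = ∀ {a b k} → Edge G v a → Edge G v b → Walk G (minus G v) a b k → a ≡ b

  off-unique-cycle⇒separating : (∀ C C' a b → CycEdge G C a b → CycEdge G C' a b) →
                                ∀ C → ¬ OnCycle G C v → Separating v
  off-unique-cycle⇒separating {v} unique C v∉C {a} {b} v~a v~b ab =
    decidable-stable (a ≟ b) (¬¬-Dist ab >>= λ (d , dist) → pure (shortest-closes d dist))
    where
    shortest-closes : ∀ d → Dist G (minus G v) a b d → a ≡ b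
    shortest-closes zero    (w , _)        = vertexAt-last w
    shortest-closes (suc d) (w , shortest) =
      contradiction (CycEdge⇒OnCycle {C = C} (unique (cycle-through v~a v~b w shortest) C v a (inj₁ (inj₁ (zero , refl , refl)))))
                    v∉C

  module Branches {v : Fin n} (separating : Separating v) where

    private
      M = minus G v
      A = All G

    Branch : Fin n → VSet G
    Branch = Reach M

    branch-avoids : Branch a b → b ≢ v
    branch-avoids (_ , w) = target∈ w

    branch-closed : Closed M (Branch a)
    branch-closed = Reach-closed

    branch-root : Edge G v a → Branch a a
    branch-root v~a = 0 , stop λ a≡v → Edge-irrefl (subst (Edge G v) a≡v v~a)

    branches-disjoint : Edge G v a → Edge G v b → a ≢ b → Branch a c → ¬ Branch b c
    branches-disjoint v~a v~b a≢b (_ , ac) (_ , bc) = a≢b (separating v~a v~b (ac ++ʷ reverseʷ bc))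

    enter-branch : c ≢ v → Walk G A c v k → ∃[ y ] (Edge G v y × Branch y c)
    enter-branch c≢v (stop _) = contradiction refl c≢v
    enter-branch {c} c≢v (step {w = w} _ c~w rest) with w ≟ v
    ... | yes refl = c , Edge-sym c~w , 0 , stop c≢v
    ... | no w≢v   = let (y , v~y , (_ , yw)) = enter-branch w≢v rest in y , v~y , _ , snocʷ yw (Edge-sym c~w) c≢v

    -- the only edge leaving a branch joins its root to v
    leave-branch : Edge G v a → Branch a b → ¬ Branch a c → Walk G A b c k →
                   ∃[ i ] ∃[ j ] (Walk G M b a i × Walk G A v c j × i + suc j ≡ k)
    leave-branch v~a ab ¬ac (stop _) = contradiction ab ¬ac
    leave-branch {b = b} v~a ab ¬ac (step {w = w} _ b~w rest) with w ≟ v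
    ... | yes refl = 0 , _ , subst (λ z → Walk G M b z 0) (sym (separating v~a (Edge-sym b~w) (proj₂ ab)))
                                   (stop (branch-avoids ab)) , rest , refl
    ... | no w≢v   = let (i , j , wa , vc , i+j+1≡k) = leave-branch v~a (branch-closed _ _ ab w≢v b~w) ¬ac rest in
                     suc i , j , step (branch-avoids ab) b~w wa , vc , cong suc i+j+1≡k

    branch-shortcut : Edge G v a → Branch a b → Branch a c → Walk G A b c k → ∃[ k' ] (k' ≤ k × Walk G M b c k')
    branch-shortcut v~a ab ac (stop _) = 0 , z≤n , stop (branch-avoids ab)
    branch-shortcut {c = c} v~a ab ac (step {w = w} _ b~w rest) with w ≟ v
    ... | no w≢v = let (k' , k'≤ , rest') = branch-shortcut v~a (branch-closed _ _ ab w≢v b~w) ac rest in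
                   suc k' , s≤s k'≤ , step (branch-avoids ab) b~w rest'
    ... | yes refl =
      let (i , j , ca , _ , i+j+1≡k) = leave-branch v~a ac (λ av → branch-avoids av refl) (reverseʷ rest) in
      i , ≤-trans (≤-trans (m≤m+n i (suc j)) (≤-reflexive i+j+1≡k)) (n≤1+n _) ,
      subst (λ z → Walk G M z c i) (separating v~a (Edge-sym b~w) (proj₂ ab)) (reverseʷ ca)

    branch-isometric : Edge G v a → Isometric (Branch a) A
    branch-isometric v~a = record
      { T⊆S      = λ _ → tt
      ; shortcut = λ ab ac w → let (k' , k'≤ , w') = branch-shortcut v~a ab ac w in
                               k' , k'≤ , restrictʷ branch-closed ab w'
      }

    branch-isometric-minus : Isometric (Branch a) M
    branch-isometric-minus = closed⇒isometric branch-avoids branch-closed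

    geodesic-through-root : Edge G v a → AllDist A → ¬ Branch a w → Branch a c → Branch a d →
                            OnGeodesic G A w c d → OnGeodesic G A a c d
    geodesic-through-root {a = a} {d = d} v~a distA ¬aw ac ad (i , j , δ , wc , cd , (wd , least) , refl)
      with leave-branch v~a ac ¬aw (reverseʷ wc)
    ... | i₁ , i₂ , ca , vw , refl with distA a d (_ , mapʷ _ (reverseʷ ca) ++ʷ cd)
    ... | δ' , ad' , least' =
      i₁ , j , i₁ + j , mapʷ _ (reverseʷ ca) , cd ,
      (subst (Walk G A a d) δ'≡i₁+j ad' , λ k w → subst (_≤ k) δ'≡i₁+j (least' k w)) , refl
      where
      round-trip : (i₁ + suc i₂) + j ≤ i₂ + suc δ'
      round-trip = least _ (reverseʷ vw ++ʷ step tt v~a ad')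
      δ'≡i₁+j : δ' ≡ i₁ + j
      δ'≡i₁+j = ≤-antisym (least' _ (mapʷ _ (reverseʷ ca) ++ʷ cd))
        (+-cancelˡ-≤ (suc i₂) _ _ (subst₂ _≤_ (solve-∀′ i₁ i₂ j) (+-suc i₂ δ') round-trip))
        where
        solve-∀′ : ∀ a b c → (a + suc b) + c ≡ suc b + (a + c)
        solve-∀′ = solve-∀

    resolves-through-root : Edge G v a → AllDist A → ¬ Branch a w → Branch a c → Branch a d →
                            StronglyResolves G A w c d → StronglyResolves G A a c d
    resolves-through-root v~a distA ¬aw ac ad (inj₁ g) = inj₁ (geodesic-through-root v~a distA ¬aw ac ad g)
    resolves-through-root v~a distA ¬aw ac ad (inj₂ g) = inj₂ (geodesic-through-root v~a distA ¬aw ad ac g)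

    Peak : Fin n → Fin n → Set
    Peak a p = ∀ z → Edge G p z → z ≢ v → ∀ {i j} → Dist G M a z i → Dist G M a p j → i ≤ j

    ¬¬-peak-beyond : OnGeodesic G M a c d → ¬ ¬ (∃[ p ] (Peak a p × StronglyResolves G M p c d))
    ¬¬-peak-beyond {a} {c} {d} (i , j , _ , ac , cd , dist-ad , refl) =
      ¬¬-greatest Beyond functional (stop (target∈ cd) , subst (Dist G M a d) (sym (+-identityʳ δ)) dist-ad)
        >>= λ (_ , _ , (dp , ap) , greatest) → pure {A = Found} (_ , peak dp ap greatest , inj₂ (sees-d dp ap))
      where
      δ = i + j
      Beyond : Fin n → ℕ → Set
      Beyond p γ = Walk G M d p γ × Dist G M a p (δ + γ)
      Found = ∃[ p ] (Peak a p × StronglyResolves G M p c d)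
      functional : ∀ {p γ γ'} → Beyond p γ → Beyond p γ' → γ ≡ γ'
      functional (_ , ap) (_ , ap') = +-cancelˡ-≡ δ _ _ (Dist-unique ap ap')
      peak : ∀ {p γ} → Walk G M d p γ → Dist G M a p (δ + γ) → (∀ {p' γ'} → Beyond p' γ' → γ' ≤ γ) → Peak a p
      peak {γ = γ} dp ap greatest z p~z z≢v {e₁} {e₂} az ap' with e₁ ≤? e₂
      ... | yes e₁≤e₂ = e₁≤e₂
      ... | no e₁≰e₂ = contradiction (greatest (snocʷ dp p~z z≢v , subst (Dist G M a _) e₁≡ az)) 1+n≰n
        where
        e₁≡ : e₁ ≡ δ + suc γ
        e₁≡ = trans (≤-antisym (proj₂ az _ (snocʷ (proj₁ ap') p~z z≢v)) (≰⇒> e₁≰e₂))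
                    (trans (cong suc (Dist-unique ap' ap)) (sym (+-suc δ γ)))
      sees-d : ∀ {p γ} → Walk G M d p γ → Dist G M a p (δ + γ) → OnGeodesic G M p d c
      sees-d {γ = γ} dp (_ , least) =
        γ , j , γ + j , reverseʷ dp , reverseʷ cd ,
        (reverseʷ dp ++ʷ reverseʷ cd ,
         λ k pc → +-cancelˡ-≤ i _ _ (subst (_≤ i + k) (reassoc i j γ) (least _ (ac ++ʷ reverseʷ pc)))) , refl
        where
        reassoc : ∀ a b c → (a + b) + c ≡ a + (c + b)
        reassoc = solve-∀

    peak-endpoint : ∀ {a c d w} → AllDist M → Edge G v a → Branch a c → Peak a c → ¬ Branch a d →
                    OnGeodesic G A w c d → w ≡ c
    peak-endpoint {a} {c} {d} {w} distM v~a ac peak ¬ad g = decidable-stable (w ≟ c) (beyond g)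
      where
      -- the vertex before c on the geodesic is v or a vertex of the branch no farther from a;
      -- either gives a shortcut
      beyond : OnGeodesic G A w c d → ¬ w ≢ c
      beyond (i , j , δ , wc , cd , (wd , least) , refl) w≢c
        with first-step (reverseʷ wc) w≢c | leave-branch v~a ac ¬ad cd
      ... | z , i' , refl , c~z , zw | j₁ , j₂ , ca , vd , refl with z ≟ v
      ... | yes refl = <⇒≱ (s≤s (+-monoʳ-≤ i' (≤-trans (n≤1+n j₂) (m≤n+m (suc j₂) j₁))))
                           (least _ (reverseʷ zw ++ʷ vd))
      ... | no z≢v =
        let (e₁ , az) = distM a z (branch-closed _ _ ac z≢v c~z)
            (e₂ , ac') = distM a c ac
            e₁≤j₁ = ≤-trans (peak z c~z z≢v az ac') (proj₂ ac' j₁ (reverseʷ ca))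
        in <⇒≱ (s≤s (+-monoʳ-≤ i' (+-monoˡ-≤ (suc j₂) e₁≤j₁)))
               (least _ (reverseʷ zw ++ʷ mapʷ _ (reverseʷ (proj₁ az)) ++ʷ step tt (Edge-sym v~a) vd))

    peaks-resolved : Resolving A W → AllDist M → Edge G v a → Edge G v b → a ≢ b →
                     Branch a c → Peak a c → Branch b d → Peak b d → c ∈ W ⊎ d ∈ W
    peaks-resolved {W = W} res distM v~a v~b a≢b ac peak-c bd peak-d
      with Resolving.resolves res tt tt c≢d (_ , c-v-d)
      where
      c≢d = λ c≡d → branches-disjoint v~a v~b a≢b ac (subst (Branch _) (sym c≡d) bd)
      c-v-d = mapʷ _ (reverseʷ (proj₂ ac)) ++ʷ step tt (Edge-sym v~a) (step tt v~b (mapʷ _ (proj₂ bd)))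
    ... | x , x∈W , inj₁ g = inj₁ (subst (_∈ W) (peak-endpoint distM v~a ac peak-c (branches-disjoint v~b v~a (≢-sym a≢b) bd) g) x∈W)
    ... | x , x∈W , inj₂ g = inj₂ (subst (_∈ W) (peak-endpoint distM v~b bd peak-d (branches-disjoint v~a v~b a≢b ac) g) x∈W)

    Covers : Subset n → Subset n → Set
    Covers W H = ∀ {a p} → Edge G v a → Branch a p → Peak a p → p ∈ W ⊎ a ∈ H

    SmallCover : Subset n → Set
    SmallCover W = ∃[ H ] (∣ H ∣ ≤ 1 × (∀ {x} → x ∈ H → x ≢ v) × Covers W H)

    ¬¬-cover : Resolving A W → AllDist M → ¬ ¬ SmallCover W
    ¬¬-cover {W} res distM = ¬¬-excluded-middle {A = Uncovered} >>= λ where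
        (no all-covered) →
          pure {A = SmallCover W} (∅ , ≤-trans (≤-reflexive (∣⊥∣≡0 n)) z≤n , (λ x∈∅ → contradiction x∈∅ ∉⊥) ,
                λ {a} {p} v~a ap peak → inj₁ (decidable-stable (p ∈? W) λ p∉W → all-covered (a , p , v~a , ap , peak , p∉W)))
        (yes (a₀ , p₀ , v~a₀ , a₀p₀ , peak₀ , p₀∉W)) →
          pure {A = SmallCover W} (⁅ a₀ ⁆ , ≤-reflexive (∣⁅x⁆∣≡1 a₀) ,
                (λ x∈ → subst (_≢ v) (sym (x∈⁅y⁆⇒x≡y a₀ x∈)) (branch-avoids (branch-root v~a₀))) ,
                cover v~a₀ a₀p₀ peak₀ p₀∉W)
      where
      Uncovered = ∃[ a ] ∃[ p ] (Edge G v a × Branch a p × Peak a p × p ∉ W)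
      -- by peaks-resolved, every peak outside W lies in the branch of a₀
      cover : ∀ {a₀ p₀} → Edge G v a₀ → Branch a₀ p₀ → Peak a₀ p₀ → p₀ ∉ W → Covers W ⁅ a₀ ⁆
      cover {a₀} v~a₀ a₀p₀ peak₀ p₀∉W {a} v~a ap peak with a ≟ a₀
      ... | yes refl = inj₂ (x∈⁅x⁆ a₀)
      ... | no a≢a₀ with peaks-resolved res distM v~a v~a₀ a≢a₀ ap peak a₀p₀ peak₀
      ...   | inj₁ p∈W  = inj₁ p∈W
      ...   | inj₂ p₀∈W = contradiction p₀∈W p₀∉W

    PeaksBeyond : Set
    PeaksBeyond = ∀ a c d → OnGeodesic G M a c d → ∃[ p ] (Peak a p × StronglyResolves G M p c d)

    ¬¬-peaksBeyond : ¬ ¬ PeaksBeyond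
    ¬¬-peaksBeyond = ¬¬-Π λ _ → ¬¬-Π λ _ → ¬¬-Π λ _ → ¬¬-→ ¬¬-peak-beyond

    resolves-away : ¬ Reach A c v → Reach M c d → StronglyResolves G A w c d → w ≢ v × StronglyResolves G M w c d
    resolves-away {c} ¬cv (_ , cd) r = avoids cw , Isometric.resolves⁺ isoM (Isometric.resolves⁻ isoA cw (0 , stop tt) (_ , mapʷ _ cd) r)
      where
      avoids : Reach A c x → x ≢ v
      avoids cx refl = ¬cv cx
      isoA = closed⇒isometric (λ _ → tt) (Reach-closed {S = A})
      isoM = closed⇒isometric avoids (Closed-⊆ (λ _ → tt) (Reach-closed {S = A}))
      cw = _ , reverseʷ (proj₂ (resolver-walk r))

    resolves-in-branch : Edge G v a → AllDist A → Branch a c → Branch a d → Dec (Branch a w) →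
                         StronglyResolves G A w c d →
                         (Branch a w × StronglyResolves G M w c d) ⊎ StronglyResolves G M a c d
    resolves-in-branch v~a distA ac ad (yes aw) r =
      inj₁ (aw , Isometric.resolves⁺ branch-isometric-minus (Isometric.resolves⁻ (branch-isometric v~a) aw ac ad r))
    resolves-in-branch v~a distA ac ad (no ¬aw) r =
      inj₂ (Isometric.resolves⁺ branch-isometric-minus (Isometric.resolves⁻ (branch-isometric v~a) (branch-root v~a) ac ad
             (resolves-through-root v~a distA ¬aw ac ad r)))

    peak-resolves : PeaksBeyond → StronglyResolves G M a c d → ∃[ p ] (Peak a p × StronglyResolves G M p c d)
    peak-resolves peaks (inj₁ g) = peaks _ _ _ g
    peak-resolves peaks (inj₂ g) = let (p , peak , r) = peaks _ _ _ g in p , peak , StronglyResolves-sym r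

    resolving-minus-v : ∀ {W H} → Resolving A W → (∀ {x} → x ∈ H → x ≢ v) → Covers W H → AllDist A → PeaksBeyond →
                      (∀ a → Decidable (Branch a)) → Decidable (λ c → Reach A c v) → Resolving M ((W - v) ∪ H)
    resolving-minus-v {W} {H} res H∌v covers distA peaks branch? reach? = record
      { W⊆S      = λ x∈ → case x∈p∪q⁻ (W - v) H x∈ of λ where
                     (inj₁ x∈W-v) x≡v → proj₂ (x∈p─q⁻ W ⁅ v ⁆ x∈W-v) (subst (_∈ ⁅ v ⁆) (sym x≡v) (x∈⁅x⁆ v))
                     (inj₂ x∈H)       → H∌v x∈H
      ; resolves = λ {c} mc _ c≢d (_ , cd) →
          let (w , w∈W , r) = Resolving.resolves res tt tt c≢d (_ , mapʷ _ cd) in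
          case reach? c of λ where
            (no ¬cv) → let (w≢v , r') = resolves-away ¬cv (_ , cd) r in w , from-W w∈W w≢v , r'
            (yes (_ , cv)) →
              let (a , v~a , ac) = enter-branch mc cv in
              case resolves-in-branch v~a distA ac (_ , proj₂ ac ++ʷ cd) (branch? a w) r of λ where
                (inj₁ (aw , r')) → w , from-W w∈W (branch-avoids aw) , r'
                (inj₂ ra)        → via-peak v~a ac ra
      }
      where
      Basis = (W - v) ∪ H
      from-W : x ∈ W → x ≢ v → x ∈ Basis
      from-W x∈W x≢v = x∈p∪q⁺ (inj₁ (x∈p∧x≢y⇒x∈p-y x∈W x≢v))
      via-peak : Edge G v a → Branch a c → StronglyResolves G M a c d → ∃[ x ] (x ∈ Basis × StronglyResolves G M x c d)
      via-peak v~a ac ra =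
        let (p , peak , rp) = peak-resolves peaks ra
            ap = _ , proj₂ ac ++ʷ reverseʷ (proj₂ (resolver-walk rp))
        in case covers v~a ap peak of λ where
             (inj₁ p∈W) → p , from-W p∈W (branch-avoids ap) , rp
             (inj₂ a∈H) → _ , x∈p∪q⁺ (inj₂ a∈H) , ra

  sdim-minus-separating : ∀ {v} → Separating v → Sdim G (minus G v) i → Sdim G (All G) j → i ≤ suc j
  sdim-minus-separating {i = i} {j = j} {v} separating sdimM sdimA =
    decidable-stable (i ≤? suc j) do
      minM    ← ¬¬-minResolving sdimM
      minA    ← ¬¬-minResolving sdimA
      distA   ← ¬¬-AllDist (All G)
      distM   ← ¬¬-AllDist (minus G v)
      peaks   ← ¬¬-peaksBeyond
      branch? ← ¬¬-Π λ a → ¬¬-decidable (Branch a)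
      reach?  ← ¬¬-decidable (λ c → Reach (All G) c v)
      let open MinResolving minA
      (H , ∣H∣≤1 , H∌v , covers) ← ¬¬-cover resolving distM
      pure (≤-trans (MinResolving.minimal minM (resolving-minus-v resolving H∌v covers distA peaks branch? reach?))
                    (≤-trans (∣p∪q∣≤∣p∣+∣q∣ (basis - v) H)
                             (≤-trans (+-mono-≤ (≤-trans (∣p─q∣≤∣p∣ basis ⁅ v ⁆) small) ∣H∣≤1)
                                      (≤-reflexive (+-comm j 1)))))
    where open Branches separating

lemma3p8 : ∀ {n} (G : Graph n) → Unicyclic G → (C : Cycle G) →
    (∀ v → Appropriate G v → ¬ OnCycle G C v →
      ∀ a b → Sdim G (minus G v) a → Sdim G (All G) b → a ≤ suc b)
    ×
    (∀ P → IsolatedPath G P →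
      ∀ a b → Sdim G (∁ P) a → Sdim G (All G) b → suc a ≡ b)
    ×
    (∀ ℓ → PeripheralLeaf G ℓ →
      ∀ a b → Sdim G (minus G ℓ) a → Sdim G (All G) b → a ≡ b)
-- part (a) holds for every vertex off the cycle
lemma3p8 G (_ , unique) C =
  (λ v _ v∉C _ _ → sdim-minus-separating G (off-unique-cycle⇒separating G unique C v∉C)) ,
  (λ P isolated _ _ → sdim-isolatedPath G isolated) ,
  (λ ℓ leaf _ _ → sdim-minus-peripheralLeaf G leaf)
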